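{- For every $g:\{0,1\}^k\times\{0,1\}^k\to\{0,1\}$ and every integer $h\ge 1$ there exists $b\in\{0,1\}$ such that the following holds: for every probability distribution $\mu$ over $b$-monochromatic rectangles of $g$ there are $X,Y\subseteq\{0,1\}^k$ of size at least $2^{k-h}$ such that $$\Pr_{R\sim\mu}[R\cap(X\times Y)\ne\varnothing]\le 2^{k-2h+1}.$$
   Context: A rectangle is a set $U\times V$ with $U,V\subseteq\{0,1\}^k$; it is $b$-monochromatic for $g$ if $g(x,y)=b$ for all $(x,y)\in U\times V$.
   Formalization: Every probability distribution μ over b-monochromatic rectangles of g has rational weights. -}

module Defs where

open import Data.Bool using (Bool; true; false; _∧_; if_then_else_)
open import Data.Nat using (ℕ; zero; suc)
open import Data.Integer using (+_)
open import Data.Vec using (Vec; []; _∷_)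
open import Data.List using (List; []; _∷_; map; _++_; concatMap; filter; length; foldr; cartesianProduct)
open import Data.Bool.ListAction using (any)
open import Data.Product using (_×_; _,_; proj₁; proj₂; Σ)
open import Data.Rational using (ℚ; _+_; _/_; 0ℚ; _≤_)
open import Relation.Binary.PropositionalEquality using (_≡_)

Bits : ℕ → Set
Bits k = Vec Bool k

allBits : (k : ℕ) → List (Bits k)
allBits zero = [] ∷ []
allBits (suc k) = map (false ∷_) (allBits k) ++ map (true ∷_) (allBits k)

Subset : ℕ → Set
Subset k = Bits k → Bool

size : {k : ℕ} → Subset k → ℕ
size {k} U = length (Data.List.filter (λ x → Relation.Nullary.Decidable.Core.T? (U x)) (allBits k))
  where import Relation.Nullary.Decidable.Core

Rectangle : ℕ → Set
Rectangle k = Subset k × Subset k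

Monochromatic : {k : ℕ} → (Bits k → Bits k → Bool) → Bool → Rectangle k → Set
Monochromatic g b (U , V) = ∀ x y → U x ≡ true → V y ≡ true → g x y ≡ b

intersects : {k : ℕ} → Rectangle k → Subset k → Subset k → Bool
intersects {k} (U , V) X Y =
  any (λ p → U (proj₁ p) ∧ V (proj₂ p) ∧ X (proj₁ p) ∧ Y (proj₂ p))
      (cartesianProduct (allBits k) (allBits k))

ℕtoℚ : ℕ → ℚ
ℕtoℚ n = + n / 1

-- A finitely supported probability distribution over rectangles, with
-- rational weights: a list of (rectangle, weight) pairs.
Distribution : ℕ → Set
Distribution k = List (Rectangle k × ℚ)

weightsNonneg : {k : ℕ} → Distribution k → Set
weightsNonneg [] = Data.Unit.⊤
  where import Data.Unit
weightsNonneg ((R , w) ∷ μ) = (0ℚ ≤ w) × weightsNonneg μ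

totalWeight : {k : ℕ} → Distribution k → ℚ
totalWeight μ = foldr (λ p acc → proj₂ p + acc) 0ℚ μ

supportedOn : {k : ℕ} → (Rectangle k → Set) → Distribution k → Set
supportedOn P [] = Data.Unit.⊤
  where import Data.Unit
supportedOn P ((R , w) ∷ μ) = P R × supportedOn P μ

prob : {k : ℕ} → Distribution k → (Rectangle k → Bool) → ℚ
prob μ E = foldr (λ p acc → if E (proj₁ p) then proj₂ p + acc else acc) 0ℚ μ

IsMonoDistribution : {k : ℕ} → (Bits k → Bits k → Bool) → Bool → Distribution k → Set
IsMonoDistribution g b μ =
  weightsNonneg μ × (totalWeight μ ≡ Data.Rational.1ℚ) × supportedOn (Monochromatic g b) μ

{-# OPTIONS --safe #-}
-- Either some 1-monochromatic rectangle U × V has both sides of size at least 2^(k-h), or every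
-- 1-monochromatic rectangle has a side smaller than 2^(k-h); which case holds is decided by searching
-- all U together with the largest V for which U × V is 1-monochromatic.
-- In the first case take b = 0: no 0-monochromatic rectangle meets U × V.
-- In the second take b = 1 and cut {0,1}^k into the 2^t blocks of strings sharing a prefix of length
-- t = min(h-1, k), each of size 2^(k-t) ≥ 2^(k-h). A rectangle meets a diagonal block B × B only if
-- both of its sides meet B, so a 1-monochromatic rectangle meets fewer than 2^(k-h) diagonal blocks.
-- Averaging over the blocks, some B × B is met with probability at most 2^(k-h) / 2^t ≤ 2^(k-2h+1).
module Submission where

open import Defs
open import Data.Bool using (Bool; true; false; not; _∧_; _∨_; if_then_else_)
open import Data.Bool.Properties using (T-≡; not-¬)
open import Data.Bool.ListAction using (and; any; all)
open import Data.List using (List; []; _∷_; _++_; map; filter; length; cartesianProduct; cartesianProductWith)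
open import Data.List.Properties using (filter-++; filter-all; filter-some; length-++; length-map; map-cong)
open import Data.List.Membership.Propositional using (_∈_; lose)
open import Data.List.Membership.Propositional.Properties using (∈-map⁺; ∈-++⁺ˡ; ∈-++⁺ʳ; ∈-cartesianProductWith⁺)
import Data.List.Relation.Unary.All as All
open import Data.List.Relation.Unary.All.Properties using (all⁺; all⁻)
open import Data.List.Relation.Unary.Any using (here; there; any?; satisfied)
open import Data.List.Relation.Unary.Any.Properties using (any⁺; any⁻)
open import Data.Nat using (ℕ; zero; suc; _+_; _*_; _^_; _∸_; _⊓_; _≥_)
open import Data.Product as Product using (Σ; ∃; _×_; _,_; proj₁; proj₂)
open import Data.Sum using (_⊎_; inj₁; inj₂)
open import Data.Unit using (tt)
open import Data.Vec using ([]; _∷_; replicate)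
open import Function using (_∘_; Equivalence)
open import Relation.Nullary using (¬_; Dec; yes; no; contradiction)
open import Relation.Nullary.Decidable using (_×-dec_)
open import Relation.Nullary.Decidable.Core using (T?)
open import Relation.Binary.PropositionalEquality using (_≡_; _≗_; refl; sym; trans; cong; cong₂; subst; module ≡-Reasoning)

private
  variable
    A I : Set
    k t : ℕ

any-true⁺ : {f : A → Bool} {x : A} {xs : List A} → x ∈ xs → f x ≡ true → any f xs ≡ true
any-true⁺ {f = f} x∈xs fx = Equivalence.to T-≡ (any⁺ f (lose x∈xs (Equivalence.from T-≡ fx)))

any-true⁻ : (f : A → Bool) (xs : List A) → any f xs ≡ true → ∃ λ x → f x ≡ true
any-true⁻ f xs e = Product.map₂ (Equivalence.to T-≡) (satisfied (any⁻ f xs (Equivalence.from T-≡ e)))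

all-true⁺ : {f : A → Bool} → (∀ x → f x ≡ true) → (xs : List A) → all f xs ≡ true
all-true⁺ {f = f} fx xs = Equivalence.to T-≡ (all⁻ f (All.universal (λ x → Equivalence.from T-≡ (fx x)) xs))

all-true⁻ : {f : A → Bool} {x : A} (xs : List A) → all f xs ≡ true → x ∈ xs → f x ≡ true
all-true⁻ {f = f} xs e x∈xs = Equivalence.to T-≡ (All.lookup (all⁺ f xs (Equivalence.from T-≡ e)) x∈xs)

∧-true : ∀ {a b} → a ∧ b ≡ true → a ≡ true × b ≡ true
∧-true {true} e = refl , e

allBits-complete : (x : Bits k) → x ∈ allBits k
allBits-complete [] = here refl
allBits-complete {suc k} (false ∷ x) = ∈-++⁺ˡ (∈-map⁺ (false ∷_) (allBits-complete x))
allBits-complete {suc k} (true ∷ x) =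
  ∈-++⁺ʳ (map (false ∷_) (allBits k)) (∈-map⁺ (true ∷_) (allBits-complete x))

supportedOn-weaken : {P Q : Rectangle k → Set} → (∀ R → P R → Q R) →
                     (μ : Distribution k) → supportedOn P μ → supportedOn Q μ
supportedOn-weaken P⇒Q [] _ = tt
supportedOn-weaken P⇒Q ((R , _) ∷ μ) (PR , Pμ) = P⇒Q R PR , supportedOn-weaken P⇒Q μ Pμ

intersects-elim : (U V X Y : Subset k) → intersects (U , V) X Y ≡ true →
                  ∃ λ x → ∃ λ y → U x ≡ true × V y ≡ true × X x ≡ true × Y y ≡ true
intersects-elim {k} U V X Y e with any-true⁻ _ (cartesianProduct (allBits k) (allBits k)) e
... | (x , y) , all4 with ∧-true all4
... | Ux , all3 with ∧-true all3
... | Vy , all2 with ∧-true all2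
... | Xx , Yy = x , y , Ux , Vy , Xx , Yy

monochromatic-disjoint : {g : Bits k → Bits k → Bool} {b : Bool} {R : Rectangle k} {X Y : Subset k} →
                         Monochromatic g b R → Monochromatic g (not b) (X , Y) → intersects R X Y ≡ false
monochromatic-disjoint {R = U , V} {X} {Y} monoR monoXY with intersects (U , V) X Y in e
... | false = refl
... | true with intersects-elim U V X Y e
... | x , y , Ux , Vy , Xx , Yy = contradiction (monoXY x y Xx Yy) (not-¬ (monoR x y Ux Vy))

commonOnes : (Bits k → Bits k → Bool) → Subset k → Subset k
commonOnes {k} g U y = all (λ x → not (U x) ∨ g x y) (allBits k)

commonOnes-monochromatic : (g : Bits k → Bits k → Bool) (U : Subset k) → Monochromatic g true (U , commonOnes g U)
commonOnes-monochromatic {k} g U x y Ux Vy =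
  subst (λ b → not b ∨ g x y ≡ true) Ux (all-true⁻ (allBits k) Vy (allBits-complete x))

commonOnes-maximal : {g : Bits k → Bits k → Bool} {U V : Subset k} → Monochromatic g true (U , V) →
                     ∀ y → V y ≡ true → commonOnes g U y ≡ true
commonOnes-maximal {k} {g} {U} mono y Vy = all-true⁺ row (allBits k)
  where
  row : ∀ x → not (U x) ∨ g x y ≡ true
  row x with U x in Ux
  ... | false = refl
  ... | true  = mono x y Ux Vy

commonOnes-cong : (g : Bits k → Bits k → Bool) {U U′ : Subset k} → U ≗ U′ → commonOnes g U ≗ commonOnes g U′
commonOnes-cong {k} g U≗U′ y = cong and (map-cong (λ x → cong (λ b → not b ∨ g x y) (U≗U′ x)) (allBits k))

byHead : Subset k → Subset k → Subset (suc k)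
byHead U₀ U₁ (false ∷ x) = U₀ x
byHead U₀ U₁ (true ∷ x) = U₁ x

subsets : (k : ℕ) → List (Subset k)
subsets zero = (λ _ → false) ∷ (λ _ → true) ∷ []
subsets (suc k) = cartesianProductWith byHead (subsets k) (subsets k)

subsets-complete : (U : Subset k) → ∃ λ U′ → U′ ∈ subsets k × U ≗ U′
subsets-complete {zero} U = (λ _ → U []) , constant∈ (U []) , λ { [] → refl }
  where
  constant∈ : (b : Bool) → (λ _ → b) ∈ subsets zero
  constant∈ false = here refl
  constant∈ true = there (here refl)
subsets-complete {suc k} U with subsets-complete (λ x → U (false ∷ x)) | subsets-complete (λ x → U (true ∷ x))
... | U₀ , U₀∈ , U≗U₀ | U₁ , U₁∈ , U≗U₁ =
  byHead U₀ U₁ , ∈-cartesianProductWith⁺ byHead U₀∈ U₁∈ , λ { (false ∷ x) → U≗U₀ x ; (true ∷ x) → U≗U₁ x }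

∃-Subset? : {P : Subset k → Set} → (∀ {U U′} → U ≗ U′ → P U → P U′) → (∀ U → Dec (P U)) → Dec (∃ P)
∃-Subset? {k} resp P? with any? P? (subsets k)
... | yes some = yes (satisfied some)
... | no none = no λ (U , PU) →
  let (U′ , U′∈ , U≗U′) = subsets-complete U in none (lose U′∈ (resp U≗U′ PU))

startsWith : Bits t → Subset k
startsWith []          _           = true
startsWith (_ ∷ _)     []          = false
startsWith (false ∷ p) (false ∷ x) = startsWith p x
startsWith (true ∷ p)  (true ∷ x)  = startsWith p x
startsWith (_ ∷ _)     (_ ∷ _)     = false

hitsDiagonalBlock : Bits t → Rectangle k → Bool
hitsDiagonalBlock p R = intersects R (startsWith p) (startsWith p)

meetsBlock : {k t : ℕ} → Subset k → Bits t → Bool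
meetsBlock {k} U []             = any U (allBits k)
meetsBlock {zero} U (_ ∷ _)     = false
meetsBlock {suc k} U (b ∷ p)    = meetsBlock (λ x → U (b ∷ x)) p

meetsBlock-intro : (U : Subset k) (p : Bits t) {x : Bits k} → U x ≡ true → startsWith p x ≡ true → meetsBlock U p ≡ true
meetsBlock-intro U []          {x}         Ux _  = any-true⁺ (allBits-complete x) Ux
meetsBlock-intro U (false ∷ p) {false ∷ x} Ux px = meetsBlock-intro (λ y → U (false ∷ y)) p Ux px
meetsBlock-intro U (true ∷ p)  {true ∷ x}  Ux px = meetsBlock-intro (λ y → U (true ∷ y)) p Ux px

module Counting where
  open import Data.Nat using (_≤_; _<_; _≤?_; z≤n; s≤s)
  open import Data.Nat.Properties

  count : (A → Bool) → List A → ℕ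
  count f xs = length (filter (λ x → T? (f x)) xs)

  count-++ : (f : A → Bool) (xs ys : List A) → count f (xs ++ ys) ≡ count f xs + count f ys
  count-++ f xs ys = trans (cong length (filter-++ (λ x → T? (f x)) xs ys)) (length-++ (filter (λ x → T? (f x)) xs))

  count-map : {B : Set} (f : A → Bool) (g : B → A) (xs : List B) → count f (map g xs) ≡ count (f ∘ g) xs
  count-map f g [] = refl
  count-map f g (x ∷ xs) with f (g x)
  ... | true  = cong suc (count-map f g xs)
  ... | false = count-map f g xs

  count-mono : {f f′ : A → Bool} → (∀ x → f x ≡ true → f′ x ≡ true) → (xs : List A) → count f xs ≤ count f′ xs
  count-mono f⇒f′ [] = z≤n
  count-mono {f = f} {f′} f⇒f′ (x ∷ xs) with f x in fx | f′ x in f′x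
  ... | false | false = count-mono f⇒f′ xs
  ... | false | true  = m≤n⇒m≤1+n (count-mono f⇒f′ xs)
  ... | true  | true  = s≤s (count-mono f⇒f′ xs)
  ... | true  | false = contradiction (trans (sym (f⇒f′ x fx)) f′x) λ ()

  count-pos : (f : A → Bool) (xs : List A) → any f xs ≡ true → 0 < count f xs
  count-pos f xs e = filter-some (λ x → T? (f x)) (any⁻ f xs (Equivalence.from T-≡ e))

  size-mono : {U V : Subset k} → (∀ x → U x ≡ true → V x ≡ true) → size U ≤ size V
  size-mono {k} U⇒V = count-mono U⇒V (allBits k)

  size-cong : {U V : Subset k} → U ≗ V → size U ≡ size V
  size-cong U≗V = ≤-antisym (size-mono (λ x → trans (sym (U≗V x)))) (size-mono (λ x → trans (U≗V x)))

  size-∷ : (U : Subset (suc k)) → size U ≡ size (λ x → U (false ∷ x)) + size (λ x → U (true ∷ x))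
  size-∷ {k} U = trans (count-++ U (map (false ∷_) (allBits k)) (map (true ∷_) (allBits k)))
                       (cong₂ _+_ (count-map U (false ∷_) (allBits k)) (count-map U (true ∷_) (allBits k)))

  length-allBits : ∀ k → length (allBits k) ≡ 2 ^ k
  length-allBits zero = refl
  length-allBits (suc k) = begin
    length (map (false ∷_) (allBits k) ++ map (true ∷_) (allBits k))
      ≡⟨ length-++ (map (false ∷_) (allBits k)) ⟩
    length (map (false ∷_) (allBits k)) + length (map (true ∷_) (allBits k))
      ≡⟨ cong₂ _+_ (length-map (false ∷_) (allBits k)) (length-map (true ∷_) (allBits k)) ⟩
    length (allBits k) + length (allBits k)
      ≡⟨ cong₂ _+_ (length-allBits k) (length-allBits k) ⟩
    2 ^ k + 2 ^ k
      ≡⟨ cong (2 ^ k +_) (+-identityʳ (2 ^ k)) ⟨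
    2 ^ suc k ∎
    where open ≡-Reasoning

  size-full : ∀ k → size {k} (λ _ → true) ≡ 2 ^ k
  size-full k = trans (cong length (filter-all (λ _ → T? true) (All.universal (λ _ → tt) (allBits k)))) (length-allBits k)

  size-empty : ∀ k → size {k} (λ _ → false) ≡ 0
  size-empty zero = refl
  size-empty (suc k) = trans (size-∷ {k = k} (λ _ → false)) (cong₂ _+_ (size-empty k) (size-empty k))

  size-startsWith : t ≤ k → (p : Bits t) → size {k} (startsWith p) ≡ 2 ^ (k ∸ t)
  size-startsWith {k = k} z≤n [] = size-full k
  size-startsWith {k = suc k} (s≤s t≤k) (false ∷ p) =
    trans (size-∷ {k = k} (startsWith (false ∷ p))) (trans (cong₂ _+_ (size-startsWith t≤k p) (size-empty k)) (+-identityʳ _))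
  size-startsWith {k = suc k} (s≤s t≤k) (true ∷ p) =
    trans (size-∷ {k = k} (startsWith (true ∷ p))) (cong₂ _+_ (size-empty k) (size-startsWith t≤k p))

  -- The blocks partition {0,1}^k, so distinct blocks met by U are met at distinct points of U.
  size-meetsBlock : ∀ t (U : Subset k) → size {t} (meetsBlock U) ≤ size U
  size-meetsBlock {k} zero U with any U (allBits k) in nonempty
  ... | true  = count-pos U (allBits k) nonempty
  ... | false = z≤n
  size-meetsBlock {zero} (suc t) U =
    ≤-trans (≤-reflexive (trans (size-∷ {k = t} (meetsBlock U)) (cong₂ _+_ (size-empty t) (size-empty t)))) z≤n
  size-meetsBlock {suc k} (suc t) U = begin
    size {suc t} (meetsBlock U)
      ≡⟨ size-∷ {k = t} (meetsBlock U) ⟩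
    size {t} (meetsBlock (λ x → U (false ∷ x))) + size {t} (meetsBlock (λ x → U (true ∷ x)))
      ≤⟨ +-mono-≤ (size-meetsBlock t _) (size-meetsBlock t _) ⟩
    size (λ x → U (false ∷ x)) + size (λ x → U (true ∷ x))
      ≡⟨ size-∷ U ⟨
    size U ∎
    where open ≤-Reasoning

  diagonal-hits-≤ : (U V : Subset k) → size {t} (λ p → hitsDiagonalBlock p (U , V)) ≤ size U ⊓ size V
  diagonal-hits-≤ {t = t} U V =
    ⊓-glb (≤-trans (count-mono (λ p → proj₁ ∘ meetsBoth p) (allBits t)) (size-meetsBlock t U))
          (≤-trans (count-mono (λ p → proj₂ ∘ meetsBoth p) (allBits t)) (size-meetsBlock t V))
    where
    meetsBoth : ∀ p → hitsDiagonalBlock p (U , V) ≡ true → meetsBlock U p ≡ true × meetsBlock V p ≡ true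
    meetsBoth p hit with intersects-elim U V (startsWith p) (startsWith p) hit
    ... | x , y , Ux , Vy , px , py = meetsBlock-intro U p Ux px , meetsBlock-intro V p Vy py

  -- n ≥ 2^(k-h), multiplied through by 2^h.
  LargeSide : (k h n : ℕ) → Set
  LargeSide k h n = 2 ^ k ≤ n * 2 ^ h

  LargeSide? : ∀ k h n → Dec (LargeSide k h n)
  LargeSide? k h n = 2 ^ k ≤? n * 2 ^ h

  LargeSide-mono : ∀ k h {m n} → m ≤ n → LargeSide k h m → LargeSide k h n
  LargeSide-mono k h m≤n large = ≤-trans large (*-monoˡ-≤ (2 ^ h) m≤n)

  large-or-thin : (g : Bits k → Bits k → Bool) {Large : ℕ → Set} →
                  (∀ n → Dec (Large n)) → (∀ {m n} → m ≤ n → Large m → Large n) →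
                    (∃ λ U → Large (size U) × Large (size (commonOnes g U)))
                  ⊎ (∀ {U V} → Monochromatic g true (U , V) → ¬ Large (size U) ⊎ ¬ Large (size V))
  large-or-thin g {Large} Large? Large-mono
    with ∃-Subset? (λ U≗U′ → Product.map (subst Large (size-cong U≗U′)) (subst Large (size-cong (commonOnes-cong g U≗U′))))
                   (λ U → Large? (size U) ×-dec Large? (size (commonOnes g U)))
  ... | yes large = inj₁ large
  ... | no ¬large = inj₂ thin
    where
    thin : ∀ {U V} → Monochromatic g true (U , V) → ¬ Large (size U) ⊎ ¬ Large (size V)
    thin {U} {V} mono with Large? (size U) | Large? (size V)
    ... | no ¬LU | _      = inj₁ ¬LU
    ... | yes _  | no ¬LV = inj₂ ¬LV
    ... | yes LU | yes LV = contradiction (U , LU , Large-mono (size-mono (commonOnes-maximal mono)) LV) ¬large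

  2^m≤2^n⇒m≤n : ∀ {m n} → 2 ^ m ≤ 2 ^ n → m ≤ n
  2^m≤2^n⇒m≤n 2^m≤2^n = ≮⇒≥ (λ n<m → <⇒≱ (^-monoʳ-< 2 (n<1+n 1) n<m) 2^m≤2^n)

  -- c ≤ 2^(k-h) forces c / 2^t ≤ 2^(k-2h+1) for t = min(h-1, k); when c > 0 we have h ≤ k, so t = h-1.
  hit-fraction-bound : ∀ c {h k} → 1 ≤ h → c * 2 ^ h ≤ 2 ^ k → c * 2 ^ (2 * h) ≤ 2 ^ (k + 1) * 2 ^ ((h ∸ 1) ⊓ k)
  hit-fraction-bound zero _ _ = z≤n
  hit-fraction-bound c@(suc _) {suc h} {k} _ c2^h≤2^k = begin
    c * 2 ^ (2 * suc h)                ≡⟨ cong (λ e → c * 2 ^ (suc h + e)) (+-identityʳ (suc h)) ⟩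
    c * 2 ^ (suc h + suc h)            ≡⟨ cong (c *_) (^-distribˡ-+-* 2 (suc h) (suc h)) ⟩
    c * (2 ^ suc h * 2 ^ suc h)        ≡⟨ *-assoc c (2 ^ suc h) (2 ^ suc h) ⟨
    c * 2 ^ suc h * 2 ^ suc h          ≤⟨ *-monoˡ-≤ (2 ^ suc h) c2^h≤2^k ⟩
    2 ^ k * 2 ^ suc h                  ≡⟨ ^-distribˡ-+-* 2 k (suc h) ⟨
    2 ^ (k + suc h)                    ≡⟨ cong (2 ^_) (+-assoc k 1 h) ⟨
    2 ^ (k + 1 + h)                    ≡⟨ ^-distribˡ-+-* 2 (k + 1) h ⟩
    2 ^ (k + 1) * 2 ^ h                ≡⟨ cong (λ e → 2 ^ (k + 1) * 2 ^ e) (m≤n⇒m⊓n≡m h≤k) ⟨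
    2 ^ (k + 1) * 2 ^ (h ⊓ k)          ∎
    where
    open ≤-Reasoning
    h≤k : h ≤ k
    h≤k = ≤-trans (n≤1+n h) (2^m≤2^n⇒m≤n (≤-trans (m≤n*m (2 ^ suc h) c) c2^h≤2^k))

  thin-diagonal-hits : ∀ {h} {U V : Subset k} → 1 ≤ h → ¬ LargeSide k h (size U) ⊎ ¬ LargeSide k h (size V) →
    size {(h ∸ 1) ⊓ k} (λ p → hitsDiagonalBlock p (U , V)) * 2 ^ (2 * h) ≤ 2 ^ (k + 1) * 2 ^ ((h ∸ 1) ⊓ k)
  thin-diagonal-hits {k} {h} {U} {V} 1≤h thin = hit-fraction-bound hits {k = k} 1≤h (begin
    hits * 2 ^ h             ≤⟨ *-monoˡ-≤ (2 ^ h) (diagonal-hits-≤ {t = (h ∸ 1) ⊓ k} U V) ⟩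
    size U ⊓ size V * 2 ^ h  ≤⟨ smallSide thin ⟩
    2 ^ k                    ∎)
    where
    open ≤-Reasoning
    hits : ℕ
    hits = size {(h ∸ 1) ⊓ k} (λ p → hitsDiagonalBlock p (U , V))
    smallSide : ¬ LargeSide k h (size U) ⊎ ¬ LargeSide k h (size V) → size U ⊓ size V * 2 ^ h ≤ 2 ^ k
    smallSide (inj₁ ¬LU) = ≤-trans (*-monoˡ-≤ (2 ^ h) (m⊓n≤m (size U) (size V))) (<⇒≤ (≰⇒> ¬LU))
    smallSide (inj₂ ¬LV) = ≤-trans (*-monoˡ-≤ (2 ^ h) (m⊓n≤n (size U) (size V))) (<⇒≤ (≰⇒> ¬LV))

  startsWith-large : ∀ {h} → t ≤ k → t ≤ h → (p : Bits t) → LargeSide k h (size {k} (startsWith p))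
  startsWith-large {t} {k} {h} t≤k t≤h p = begin
    2 ^ k                      ≤⟨ ^-monoʳ-≤ 2 k≤k∸t+h ⟩
    2 ^ (k ∸ t + h)            ≡⟨ ^-distribˡ-+-* 2 (k ∸ t) h ⟩
    2 ^ (k ∸ t) * 2 ^ h        ≡⟨ cong (_* 2 ^ h) (size-startsWith t≤k p) ⟨
    size {k} (startsWith p) * 2 ^ h ∎
    where
    open ≤-Reasoning
    k≤k∸t+h : k ≤ k ∸ t + h
    k≤k∸t+h = ≤-trans (≤-reflexive (sym (m∸n+n≡m t≤k))) (+-monoʳ-≤ (k ∸ t) t≤h)

open Counting

module Averaging where
  import Data.Nat as ℕ
  import Data.Nat.Properties as ℕ
  open import Data.Integer as ℤ using (+_)
  import Data.Integer.Properties as ℤ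
  import Data.Nat.Coprimality as Coprime
  open import Data.Rational using (ℚ; mkℚ; 0ℚ; 1ℚ; *≤*; Positive; NonNegative; nonNegative; _≤_)
    renaming (_+_ to _+ℚ_; _*_ to _*ℚ_)
  open import Data.Rational.Properties
  open import Data.Rational.Unnormalised using (*≡*)
  import Data.Rational.Unnormalised.Properties as ℚᵘ
  open import Data.Rational.Solver using (module +-*-Solver)
  open +-*-Solver using (solve; _:+_; _:*_; _:=_; con)

  -- ℕtoℚ n = + n / 1 is stuck on gcd n 1; its normal form below computes.
  private
    ℕtoℚ-reduced : ℕ → ℚ
    ℕtoℚ-reduced n = mkℚ (+ n) 0 (Coprime.sym (Coprime.1-coprimeTo n))

    ℕtoℚ≡reduced : ∀ n → ℕtoℚ n ≡ ℕtoℚ-reduced n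
    ℕtoℚ≡reduced n = ↥p/↧p≡p (ℕtoℚ-reduced n)

  ℕtoℚ-homo-+ : ∀ m n → ℕtoℚ (m + n) ≡ ℕtoℚ m +ℚ ℕtoℚ n
  ℕtoℚ-homo-+ m n rewrite ℕtoℚ≡reduced (m + n) | ℕtoℚ≡reduced m | ℕtoℚ≡reduced n =
    toℚᵘ-injective (ℚᵘ.≃-trans (*≡* numerators) (ℚᵘ.≃-sym (toℚᵘ-homo-+ (ℕtoℚ-reduced m) (ℕtoℚ-reduced n))))
    where
    numerators : + (m + n) ℤ.* + 1 ≡ (+ m ℤ.* + 1 ℤ.+ + n ℤ.* + 1) ℤ.* + 1
    numerators rewrite ℤ.*-identityʳ (+ m) | ℤ.*-identityʳ (+ n) = cong (ℤ._* + 1) (ℤ.pos-+ m n)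

  ℕtoℚ-homo-* : ∀ m n → ℕtoℚ (m * n) ≡ ℕtoℚ m *ℚ ℕtoℚ n
  ℕtoℚ-homo-* m n rewrite ℕtoℚ≡reduced (m * n) | ℕtoℚ≡reduced m | ℕtoℚ≡reduced n =
    toℚᵘ-injective (ℚᵘ.≃-trans (*≡* (cong (ℤ._* + 1) (ℤ.pos-* m n)))
                               (ℚᵘ.≃-sym (toℚᵘ-homo-* (ℕtoℚ-reduced m) (ℕtoℚ-reduced n))))

  ℕtoℚ-mono-≤ : ∀ {m n} → m ℕ.≤ n → ℕtoℚ m ≤ ℕtoℚ n
  ℕtoℚ-mono-≤ {m} {n} m≤n rewrite ℕtoℚ≡reduced m | ℕtoℚ≡reduced n =
    *≤* (ℤ.*-monoʳ-≤-nonNeg (+ 1) {+ m} {+ n} (ℤ.+≤+ m≤n))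

  ℕtoℚ-nonNeg : ∀ n → NonNegative (ℕtoℚ n)
  ℕtoℚ-nonNeg n = nonNegative (ℕtoℚ-mono-≤ {0} {n} ℕ.z≤n)

  ℕtoℚ-pos : ∀ n .{{_ : ℕ.NonZero n}} → Positive (ℕtoℚ n)
  ℕtoℚ-pos (suc n) = subst Positive (sym (ℕtoℚ≡reduced (suc n))) _

  ∑ : (A → ℚ) → List A → ℚ
  ∑ f [] = 0ℚ
  ∑ f (x ∷ xs) = f x +ℚ ∑ f xs

  ∑-zero : (xs : List A) → ∑ (λ _ → 0ℚ) xs ≡ 0ℚ
  ∑-zero [] = refl
  ∑-zero (x ∷ xs) = trans (+-identityˡ (∑ (λ _ → 0ℚ) xs)) (∑-zero xs)

  private
    ≤-mean-∷ : ∀ n {m a b S} → m ≤ a → m ≤ b → ℕtoℚ n *ℚ b ≤ S → ℕtoℚ (suc n) *ℚ m ≤ a +ℚ S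
    ≤-mean-∷ n {m} {a} {b} {S} m≤a m≤b nb≤S = begin
      ℕtoℚ (suc n) *ℚ m         ≡⟨ cong (_*ℚ m) (ℕtoℚ-homo-+ 1 n) ⟩
      (1ℚ +ℚ ℕtoℚ n) *ℚ m       ≡⟨ solve 2 (λ n m → (con 1ℚ :+ n) :* m := m :+ n :* m) refl (ℕtoℚ n) m ⟩
      m +ℚ ℕtoℚ n *ℚ m          ≤⟨ +-mono-≤ m≤a (*-monoˡ-≤-nonNeg (ℕtoℚ n) {{ℕtoℚ-nonNeg n}} m≤b) ⟩
      a +ℚ ℕtoℚ n *ℚ b          ≤⟨ +-monoʳ-≤ a nb≤S ⟩
      a +ℚ S                    ∎
      where open ≤-Reasoning

  -- The seed i₀ is returned only for the empty list.
  ∃-below-mean : (f : A → ℚ) → A → (xs : List A) → ∃ λ i → ℕtoℚ (length xs) *ℚ f i ≤ ∑ f xs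
  ∃-below-mean f i₀ [] = i₀ , ≤-reflexive (*-zeroˡ (f i₀))
  ∃-below-mean f i₀ (x ∷ xs) with ∃-below-mean f i₀ xs
  ... | j , below with ≤-total (f x) (f j)
  ...   | inj₁ fx≤fj = x , ≤-mean-∷ (length xs) ≤-refl fx≤fj below
  ...   | inj₂ fj≤fx = j , ≤-mean-∷ (length xs) fj≤fx ≤-refl below

  prob-null : (E : Rectangle k → Bool) (μ : Distribution k) → supportedOn (λ R → E R ≡ false) μ → prob μ E ≡ 0ℚ
  prob-null E [] _ = refl
  prob-null E ((R , w) ∷ μ) (ER≡false , null) rewrite ER≡false = prob-null E μ null

  ∑-if : (b : I → Bool) (w : ℚ) (f : I → ℚ) (is : List I) →
    ∑ (λ i → if b i then w +ℚ f i else f i) is ≡ w *ℚ ℕtoℚ (count b is) +ℚ ∑ f is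
  ∑-if b w f [] = sym (trans (+-identityʳ (w *ℚ 0ℚ)) (*-zeroʳ w))
  ∑-if b w f (i ∷ is) with b i | ∑-if b w f is
  ... | true | ih =
    trans (cong ((w +ℚ f i) +ℚ_) ih)
      (trans (solve 4 (λ w x c s → (w :+ x) :+ (w :* c :+ s) := w :* (con 1ℚ :+ c) :+ (x :+ s)) refl w (f i) (ℕtoℚ c) (∑ f is))
             (cong (λ n → w *ℚ n +ℚ (f i +ℚ ∑ f is)) (sym (ℕtoℚ-homo-+ 1 c))))
    where
    c : ℕ
    c = count b is
  ... | false | ih =
    trans (cong (f i +ℚ_) ih) (solve 3 (λ x wc s → x :+ (wc :+ s) := wc :+ (x :+ s)) refl (f i) (w *ℚ ℕtoℚ (count b is)) (∑ f is))

  -- Double counting: Σᵢ Pr[Eᵢ] is the expected number of events that occur.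
  ∑-prob-≤ : (E : I → Rectangle k → Bool) (is : List I) {Q M : ℕ} (μ : Distribution k) → weightsNonneg μ →
    supportedOn (λ R → count (λ i → E i R) is * Q ℕ.≤ M) μ →
    ∑ (λ i → prob μ (E i)) is *ℚ ℕtoℚ Q ≤ totalWeight μ *ℚ ℕtoℚ M
  ∑-prob-≤ E is {Q} {M} [] _ _ =
    ≤-reflexive (trans (cong (_*ℚ ℕtoℚ Q) (∑-zero is)) (trans (*-zeroˡ (ℕtoℚ Q)) (sym (*-zeroˡ (ℕtoℚ M)))))
  ∑-prob-≤ E is {Q} {M} ((R , w) ∷ μ) (0≤w , nonneg) (few , fews) = begin
    ∑ (λ i → prob ((R , w) ∷ μ) (E i)) is *ℚ ℕtoℚ Q   ≡⟨ cong (_*ℚ ℕtoℚ Q) (∑-if (λ i → E i R) w (λ i → prob μ (E i)) is) ⟩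
    (w *ℚ ℕtoℚ c +ℚ S) *ℚ ℕtoℚ Q                      ≡⟨ solve 4 (λ w c S Q → (w :* c :+ S) :* Q := w :* (c :* Q) :+ S :* Q) refl w (ℕtoℚ c) S (ℕtoℚ Q) ⟩
    w *ℚ (ℕtoℚ c *ℚ ℕtoℚ Q) +ℚ S *ℚ ℕtoℚ Q           ≤⟨ +-mono-≤ (*-monoˡ-≤-nonNeg w {{nonNegative 0≤w}} cQ≤M) (∑-prob-≤ E is μ nonneg fews) ⟩
    w *ℚ ℕtoℚ M +ℚ totalWeight μ *ℚ ℕtoℚ M           ≡⟨ *-distribʳ-+ (ℕtoℚ M) w (totalWeight μ) ⟨
    (w +ℚ totalWeight μ) *ℚ ℕtoℚ M                    ∎
    where
    open ≤-Reasoning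
    c : ℕ
    c = count (λ i → E i R) is
    S : ℚ
    S = ∑ (λ i → prob μ (E i)) is
    cQ≤M : ℕtoℚ c *ℚ ℕtoℚ Q ≤ ℕtoℚ M
    cQ≤M = ≤-trans (≤-reflexive (sym (ℕtoℚ-homo-* c Q))) (ℕtoℚ-mono-≤ few)

  averaging : (E : Bits t → Rectangle k → Bool) {Q N : ℕ} (μ : Distribution k) →
    weightsNonneg μ → totalWeight μ ≡ 1ℚ →
    supportedOn (λ R → size (λ p → E p R) * Q ℕ.≤ N * 2 ^ t) μ →
    ∃ λ p → prob μ (E p) *ℚ ℕtoℚ Q ≤ ℕtoℚ N
  averaging {t} E {Q} {N} μ nonneg total few with ∃-below-mean (λ p → prob μ (E p)) (replicate t false) (allBits t)
  ... | p , below = p , *-cancelʳ-≤-pos (ℕtoℚ (2 ^ t)) {{ℕtoℚ-pos (2 ^ t) {{ℕ.m^n≢0 2 t}}}} (begin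
    prob μ (E p) *ℚ ℕtoℚ Q *ℚ ℕtoℚ (2 ^ t)
      ≡⟨ solve 3 (λ x q n → x :* q :* n := n :* x :* q) refl (prob μ (E p)) (ℕtoℚ Q) (ℕtoℚ (2 ^ t)) ⟩
    ℕtoℚ (2 ^ t) *ℚ prob μ (E p) *ℚ ℕtoℚ Q
      ≡⟨ cong (λ n → ℕtoℚ n *ℚ prob μ (E p) *ℚ ℕtoℚ Q) (length-allBits t) ⟨
    ℕtoℚ (length (allBits t)) *ℚ prob μ (E p) *ℚ ℕtoℚ Q
      ≤⟨ *-monoʳ-≤-nonNeg (ℕtoℚ Q) {{ℕtoℚ-nonNeg Q}} below ⟩
    ∑ (λ p → prob μ (E p)) (allBits t) *ℚ ℕtoℚ Q
      ≤⟨ ∑-prob-≤ E (allBits t) μ nonneg few ⟩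
    totalWeight μ *ℚ ℕtoℚ (N * 2 ^ t)
      ≡⟨ cong (_*ℚ ℕtoℚ (N * 2 ^ t)) total ⟩
    1ℚ *ℚ ℕtoℚ (N * 2 ^ t)
      ≡⟨ *-identityˡ (ℕtoℚ (N * 2 ^ t)) ⟩
    ℕtoℚ (N * 2 ^ t)
      ≡⟨ ℕtoℚ-homo-* N (2 ^ t) ⟩
    ℕtoℚ N *ℚ ℕtoℚ (2 ^ t) ∎)
    where open ≤-Reasoning

open Averaging

open import Data.Rational using (_≤_) renaming (_*_ to _*ℚ_)
import Data.Rational as ℚ
import Data.Rational.Properties as ℚ
import Data.Nat as ℕ
import Data.Nat.Properties as ℕ

RarelyHit : {k : ℕ} → (Bits k → Bits k → Bool) → ℕ → Bool → Set
RarelyHit {k} g h b = (μ : Distribution k) → IsMonoDistribution g b μ →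
  Σ (Subset k) λ X → Σ (Subset k) λ Y → LargeSide k h (size X) × LargeSide k h (size Y) ×
    (prob μ (λ R → intersects R X Y) *ℚ ℕtoℚ (2 ^ (2 * h)) ≤ ℕtoℚ (2 ^ (k + 1)))

rarelyHit-false : (g : Bits k → Bits k → Bool) (h : ℕ) {U : Subset k} →
  LargeSide k h (size U) → LargeSide k h (size (commonOnes g U)) → RarelyHit g h false
rarelyHit-false {k} g h {U} U-large V-large μ (_ , _ , mono₀) =
  U , commonOnes g U , U-large , V-large , (begin
    prob μ (λ R → intersects R U (commonOnes g U)) *ℚ ℕtoℚ (2 ^ (2 * h))  ≡⟨ cong (_*ℚ ℕtoℚ (2 ^ (2 * h))) never ⟩
    ℚ.0ℚ *ℚ ℕtoℚ (2 ^ (2 * h))                                          ≡⟨ ℚ.*-zeroˡ (ℕtoℚ (2 ^ (2 * h))) ⟩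
    ℕtoℚ 0                                                              ≤⟨ ℕtoℚ-mono-≤ {0} {2 ^ (k + 1)} ℕ.z≤n ⟩
    ℕtoℚ (2 ^ (k + 1))                                                  ∎)
  where
  open ℚ.≤-Reasoning
  never : prob μ (λ R → intersects R U (commonOnes g U)) ≡ ℚ.0ℚ
  never = prob-null _ μ (supportedOn-weaken (λ R mono → monochromatic-disjoint mono (commonOnes-monochromatic g U)) μ mono₀)

rarelyHit-true : (g : Bits k → Bits k → Bool) (h : ℕ) → h ≥ 1 →
  (∀ {U V} → Monochromatic g true (U , V) → ¬ LargeSide k h (size U) ⊎ ¬ LargeSide k h (size V)) →
  RarelyHit g h true
rarelyHit-true {k} g h h≥1 thin μ (nonneg , total , mono₁) =
  let (p , rare) = averaging {depth} hitsDiagonalBlock {2 ^ (2 * h)} {2 ^ (k + 1)} μ nonneg total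
                             (supportedOn-weaken fewHits μ mono₁)
  in startsWith p , startsWith p , block-large p , block-large p , rare
  where
  depth : ℕ
  depth = (h ∸ 1) ⊓ k
  fewHits : ∀ R → Monochromatic g true R →
            size {depth} (λ p → hitsDiagonalBlock p R) * 2 ^ (2 * h) ℕ.≤ 2 ^ (k + 1) * 2 ^ depth
  fewHits (U , V) mono = thin-diagonal-hits {k} {h} {U} {V} h≥1 (thin {U} {V} mono)
  block-large : (p : Bits depth) → LargeSide k h (size {k} (startsWith p))
  block-large = startsWith-large (ℕ.m⊓n≤n (h ∸ 1) k) (ℕ.≤-trans (ℕ.m⊓n≤m (h ∸ 1) k) (ℕ.m∸n≤m h 1))

proposition3 : (k : ℕ) (g : Bits k → Bits k → Bool) (h : ℕ) → h ≥ 1 →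
    Σ Bool λ b → (μ : Distribution k) → IsMonoDistribution g b μ →
      Σ (Subset k) λ X → Σ (Subset k) λ Y →
        -- |X| ≥ 2^(k-h) and |Y| ≥ 2^(k-h), i.e. |X|·2^h ≥ 2^k
        (size X * 2 ^ h ≥ 2 ^ k) × (size Y * 2 ^ h ≥ 2 ^ k) ×
        -- Pr[R ∩ (X×Y) ≠ ∅] ≤ 2^(k-2h+1), i.e. Pr · 2^(2h) ≤ 2^(k+1)
        (prob μ (λ R → intersects R X Y) *ℚ ℕtoℚ (2 ^ (2 * h)) ≤ ℕtoℚ (2 ^ (k + 1)))
proposition3 k g h h≥1 with large-or-thin g (LargeSide? k h) (LargeSide-mono k h)
... | inj₁ (U , U-large , V-large) = false , rarelyHit-false g h U-large V-large
... | inj₂ thin = true , rarelyHit-true g h h≥1 thin
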